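{- For $n\ge0$ let $\mathcal S_n$ be the set of zigzag knight's paths (ending on the $x$-axis) of length $2n$, $\mathcal S=\bigcup_n\mathcal S_n$, and let $\mathcal D_n$ be the set of Dyck paths of length $2n$, $\mathcal D=\bigcup_n\mathcal D_n$. Define $\phi:\mathcal S\to\mathcal D$ recursively (writing paths as words): $\phi(\epsilon)=UD$; $\phi(E\bar E\beta)=U\phi(\beta)D$; $\phi(N\bar N\beta)=UD\phi(\beta)$; $\phi(N\bar E\beta E\bar N\gamma)=U\phi(\beta)D\phi(\gamma)$, for $\beta,\gamma\in\mathcal S$. Then for every $n\ge0$, $\phi$ induces a bijection between $\mathcal S_n$ and $\mathcal D_{n+1}$.
   Context: Let $N=(1,2)$, $\bar N=(1,-2)$, $E=(2,1)$, $\bar E=(2,-1)$; $N,E$ are up-steps and $\bar N,\bar E$ are down-steps. A knight's path is a lattice path in $\mathbb N^2$ starting at $(0,0)$, ending on the $x$-axis, with steps in $\{N,\bar N,E,\bar E\}$. A zigzag knight's path is a knight's path in which consecutive steps alternate between up-steps and down-steps; $\epsilon$ is the empty path; the length of a path is its number of steps. Every nonempty zigzag knight's path can be written uniquely in one of the forms $N\bar N\beta$, $E\bar E\beta$, $N\bar E\beta E\bar N\gamma$ with $\beta,\gamma$ (possibly empty) zigzag knight's paths. A Dyck path of length $2n$ is a lattice path in $\mathbb N^2$ from $(0,0)$ to $(2n,0)$ with steps $U=(1,1)$ and $D=(1,-1)$. -}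

module Defs where

open import Data.Nat using (ℕ; zero; suc; _+_; _*_)
open import Data.Unit using (⊤)
open import Data.Bool using (Bool; true; false)
open import Data.List using (List; []; _∷_; _++_; length)
open import Data.Product using (_×_)
open import Relation.Binary.PropositionalEquality using (_≡_; _≢_)

-- Knight steps: N=(1,2), N̄=(1,-2), E=(2,1), Ē=(2,-1)
data KStep : Set where
  N N̄ E Ē : KStep

isUp : KStep → Bool
isUp N  = true
isUp E  = true
isUp N̄  = false
isUp Ē  = false

-- KnightFrom h p : the step word p, started at height h, stays in ℕ² and ends
-- on the x-axis (x-coordinates are automatically nonnegative).
data KnightFrom : ℕ → List KStep → Set where
  done  : KnightFrom 0 []
  stepN  : ∀ {h p} → KnightFrom (2 + h) p → KnightFrom h (N ∷ p)
  stepE  : ∀ {h p} → KnightFrom (1 + h) p → KnightFrom h (E ∷ p)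
  stepN̄  : ∀ {h p} → KnightFrom h p → KnightFrom (2 + h) (N̄ ∷ p)
  stepĒ  : ∀ {h p} → KnightFrom h p → KnightFrom (1 + h) (Ē ∷ p)

KnightPath : List KStep → Set
KnightPath = KnightFrom 0

Alternating : List KStep → Set
Alternating []           = ⊤
Alternating (x ∷ [])     = ⊤
Alternating (x ∷ y ∷ p)  = (isUp x ≢ isUp y) × Alternating (y ∷ p)

Zigzag : List KStep → Set
Zigzag p = KnightPath p × Alternating p

InS : ℕ → List KStep → Set
InS n p = Zigzag p × length p ≡ 2 * n

data DStep : Set where
  U D : DStep

data DyckFrom : ℕ → List DStep → Set where
  done  : DyckFrom 0 []
  stepU : ∀ {h p} → DyckFrom (suc h) p → DyckFrom h (U ∷ p)
  stepD : ∀ {h p} → DyckFrom h p → DyckFrom (suc h) (D ∷ p)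

DyckPath : List DStep → Set
DyckPath = DyckFrom 0

InD : ℕ → List DStep → Set
InD n d = DyckPath d × length d ≡ 2 * n

data Phi : List KStep → List DStep → Set where
  φε  : Phi [] (U ∷ D ∷ [])
  φEĒ : ∀ {β d} → Zigzag β → Phi β d →
        Phi (E ∷ Ē ∷ β) (U ∷ d ++ D ∷ [])
  φNN̄ : ∀ {β d} → Zigzag β → Phi β d →
        Phi (N ∷ N̄ ∷ β) (U ∷ D ∷ d)
  φNĒ : ∀ {β γ d e} → Zigzag β → Zigzag γ → Phi β d → Phi γ e →
        Phi (N ∷ Ē ∷ β ++ E ∷ N̄ ∷ γ) (U ∷ d ++ D ∷ e)

-- Reading a zigzag knight's path two steps at a time gives a Motzkin path with
-- two kinds of level steps (N N̄ and E Ē), up-steps N Ē and down-steps E N̄.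
-- Its first-return decomposition is exactly the grammar ε | N N̄ β | E Ē β |
-- N Ē β E N̄ γ, while a nonempty Dyck path decomposes uniquely as U x D y with
-- x, y Dyck paths.  The four clauses of φ send the four grammar cases to the
-- four possibilities "x, y empty or not", so φ is a bijection of grammars.
-- Both decompositions are unique because the height reached after reading a
-- prefix is determined by the prefix, and a path that has returned to the
-- ground cannot continue with the separating down-word.
module Submission where

open import Defs
open import Data.Bool using (false)
open import Data.Bool.Properties using (not-¬)
open import Data.Empty using (⊥; ⊥-elim)
open import Data.List using (List; []; _∷_; _++_; length)
open import Data.List.Properties
  using (∷-injective; ∷-injectiveʳ; ++-assoc; ++-cancelˡ; length-++; length-++-sucʳ)
open import Data.Nat using (ℕ; suc; _+_)
open import Data.Nat.Properties using (+-identityʳ; +-cancelˡ-≡; *-suc)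
open import Data.Product using (Σ; ∃-syntax; _×_; _,_; proj₁; proj₂)
open import Data.Unit using (tt)
open import Relation.Binary.PropositionalEquality
  using (_≡_; _≢_; refl; sym; trans; cong; cong₂; subst; module ≡-Reasoning)

module Motzkin {A : Set} (Level : List A → Set) (u v : List A) where

  data Path : ℕ → List A → Set where
    done  : Path 0 []
    level : ∀ {h w s} → Level w → Path h s → Path h (w ++ s)
    up    : ∀ {h s} → Path (suc h) s → Path h (u ++ s)
    down  : ∀ {h s} → Path h s → Path (suc h) (v ++ s)

  data Tree : List A → Set where
    leaf  : Tree []
    level : ∀ {w s} → Level w → Tree s → Tree (w ++ s)
    node  : ∀ {x y} → Tree x → Tree y → Tree (u ++ x ++ v ++ y)

  path-++ : ∀ {h k x y} → Path h x → Path k y → Path (h + k) (x ++ y)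
  path-++ done q = q
  path-++ {y = y} (level {w = w} {s} l p) q =
    subst (Path _) (sym (++-assoc w s y)) (level l (path-++ p q))
  path-++ {y = y} (up {s = s} p) q = subst (Path _) (sym (++-assoc u s y)) (up (path-++ p q))
  path-++ {y = y} (down {s = s} p) q = subst (Path _) (sym (++-assoc v s y)) (down (path-++ p q))

  tree⇒path : ∀ {s} → Tree s → Path 0 s
  tree⇒path leaf        = done
  tree⇒path (level l t) = level l (tree⇒path t)
  tree⇒path (node x y)  = up (path-++ (tree⇒path x) (down (tree⇒path y)))

  data Forest : ℕ → List A → Set where
    last : ∀ {t} → Tree t → Forest 0 t
    _∷_  : ∀ {h t s} → Tree t → Forest h s → Forest (suc h) (t ++ v ++ s)

  map-first : ∀ {h s} (f : List A → List A) → (∀ x y → f x ++ y ≡ f (x ++ y)) →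
              (∀ {t} → Tree t → Tree (f t)) → Forest h s → Forest h (f s)
  map-first f f-++ g (last t) = last (g t)
  map-first f f-++ g (_∷_ {t = t} {s} r rs) = subst (Forest _) (f-++ t (v ++ s)) (g r ∷ rs)

  up-forest : ∀ {h s} → Forest (suc h) s → Forest h (u ++ s)
  up-forest (_∷_ {t = t} r rs) = map-first (λ x → u ++ t ++ v ++ x) reassoc (node r) rs
    where
    open ≡-Reasoning
    reassoc : ∀ x y → (u ++ t ++ v ++ x) ++ y ≡ u ++ t ++ v ++ x ++ y
    reassoc x y = begin
      (u ++ t ++ v ++ x) ++ y  ≡⟨ ++-assoc u _ y ⟩
      u ++ (t ++ v ++ x) ++ y  ≡⟨ cong (u ++_) (++-assoc t _ y) ⟩
      u ++ t ++ (v ++ x) ++ y  ≡⟨ cong (λ z → u ++ t ++ z) (++-assoc v x y) ⟩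
      u ++ t ++ v ++ x ++ y    ∎

  path⇒forest : ∀ {h s} → Path h s → Forest h s
  path⇒forest done                = last leaf
  path⇒forest (level {w = w} l p) = map-first (w ++_) (++-assoc w) (level l) (path⇒forest p)
  path⇒forest (up p)              = up-forest (path⇒forest p)
  path⇒forest (down p)            = leaf ∷ path⇒forest p

  path⇒tree : ∀ {s} → Path 0 s → Tree s
  path⇒tree p with path⇒forest p
  ... | last t = t

-- For paths whose height after a prefix is determined by the prefix (tails),
-- a factorisation x ++ sep ++ y with x a complete path is unique.
module FirstSeparator {A : Set} (P : ℕ → List A → Set) (sep : List A)
  (empty-at-ground : ∀ {h} → P h [] → h ≡ 0)
  (tails : ∀ {h a x x′} → P h (a ∷ x) → P h (a ∷ x′) → ∃[ h′ ] P h′ x × P h′ x′)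
  (sep-not-from-ground : ∀ {a z w y} → P 0 (a ∷ z) → (a ∷ z) ++ w ≢ sep ++ y)
  where

  split : ∀ {h x x′ y y′} → P h x → P h x′ → x ++ sep ++ y ≡ x′ ++ sep ++ y′ →
          x ≡ x′ × y ≡ y′
  split {x = []} {[]} _ _ eq = refl , ++-cancelˡ sep _ _ eq
  split {x = []} {_ ∷ _} p p′ eq with empty-at-ground p
  ... | refl = ⊥-elim (sep-not-from-ground p′ (sym eq))
  split {x = _ ∷ _} {[]} p p′ eq with empty-at-ground p′
  ... | refl = ⊥-elim (sep-not-from-ground p eq)
  split {x = a ∷ _} {_ ∷ _} p p′ eq with ∷-injective eq
  ... | refl , eq′ with tails p p′
  ... | _ , q , q′ with split q q′ eq′
  ... | refl , y≡y′ = refl , y≡y′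

module Dyck = Motzkin {DStep} (λ _ → ⊥) (U ∷ []) (D ∷ [])

dyckFrom⇒path : ∀ {h s} → DyckFrom h s → Dyck.Path h s
dyckFrom⇒path done      = Dyck.done
dyckFrom⇒path (stepU p) = Dyck.up (dyckFrom⇒path p)
dyckFrom⇒path (stepD p) = Dyck.down (dyckFrom⇒path p)

path⇒dyckFrom : ∀ {h s} → Dyck.Path h s → DyckFrom h s
path⇒dyckFrom Dyck.done         = done
path⇒dyckFrom (Dyck.level () _)
path⇒dyckFrom (Dyck.up p)       = stepU (path⇒dyckFrom p)
path⇒dyckFrom (Dyck.down p)     = stepD (path⇒dyckFrom p)

dyckFrom-[] : ∀ {h} → DyckFrom h [] → h ≡ 0
dyckFrom-[] done = refl

dyckFrom-tails : ∀ {h a x x′} → DyckFrom h (a ∷ x) → DyckFrom h (a ∷ x′) →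
                 ∃[ h′ ] DyckFrom h′ x × DyckFrom h′ x′
dyckFrom-tails (stepU p) (stepU q) = _ , p , q
dyckFrom-tails (stepD p) (stepD q) = _ , p , q

dyckFrom0-¬D : ∀ {a z w y} → DyckFrom 0 (a ∷ z) → (a ∷ z) ++ w ≢ D ∷ y
dyckFrom0-¬D (stepU _) ()

module DyckSplit = FirstSeparator DyckFrom (D ∷ []) dyckFrom-[] dyckFrom-tails dyckFrom0-¬D

first-return : ∀ {x x′ y y′} → DyckPath x → DyckPath x′ →
               U ∷ x ++ D ∷ y ≡ U ∷ x′ ++ D ∷ y′ → x ≡ x′ × y ≡ y′
first-return p q eq = DyckSplit.split p q (∷-injectiveʳ eq)

data LevelPair : List KStep → Set where
  NN̄ : LevelPair (N ∷ N̄ ∷ [])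
  EĒ : LevelPair (E ∷ Ē ∷ [])

module Knight = Motzkin LevelPair (N ∷ Ē ∷ []) (E ∷ N̄ ∷ [])
open Knight using (done; level; up; down; leaf; node)

-- The alternation of a path is tracked together with the down-step d preceding it.
knight⇒path : ∀ {h s d} → isUp d ≡ false → KnightFrom h s → Alternating (d ∷ s) →
              Knight.Path h s
knight⇒path _  done                 _            = done
knight⇒path d↓ (stepN̄ _)            (d≢ , _)     = ⊥-elim (d≢ d↓)
knight⇒path d↓ (stepĒ _)            (d≢ , _)     = ⊥-elim (d≢ d↓)
knight⇒path _  (stepN (stepN _))    (_ , ≢ , _)  = ⊥-elim (≢ refl)
knight⇒path _  (stepN (stepE _))    (_ , ≢ , _)  = ⊥-elim (≢ refl)
knight⇒path _  (stepE (stepN _))    (_ , ≢ , _)  = ⊥-elim (≢ refl)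
knight⇒path _  (stepE (stepE _))    (_ , ≢ , _)  = ⊥-elim (≢ refl)
knight⇒path _  (stepN (stepN̄ k))    (_ , _ , a)  = level NN̄ (knight⇒path refl k a)
knight⇒path _  (stepE (stepĒ k))    (_ , _ , a)  = level EĒ (knight⇒path refl k a)
knight⇒path _  (stepN (stepĒ k))    (_ , _ , a)  = up (knight⇒path refl k a)
knight⇒path _  (stepE (stepN̄ k))    (_ , _ , a)  = down (knight⇒path refl k a)

path⇒knight : ∀ {h s} → Knight.Path h s → KnightFrom h s
path⇒knight done           = done
path⇒knight (level NN̄ p)   = stepN (stepN̄ (path⇒knight p))
path⇒knight (level EĒ p)   = stepE (stepĒ (path⇒knight p))
path⇒knight (up p)         = stepN (stepĒ (path⇒knight p))
path⇒knight (down p)       = stepE (stepN̄ (path⇒knight p))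

path⇒alternating : ∀ {h s d} → isUp d ≡ false → Knight.Path h s → Alternating (d ∷ s)
path⇒alternating _  done         = tt
path⇒alternating d↓ (level NN̄ p) = not-¬ d↓ , (λ ()) , path⇒alternating refl p
path⇒alternating d↓ (level EĒ p) = not-¬ d↓ , (λ ()) , path⇒alternating refl p
path⇒alternating d↓ (up p)       = not-¬ d↓ , (λ ()) , path⇒alternating refl p
path⇒alternating d↓ (down p)     = not-¬ d↓ , (λ ()) , path⇒alternating refl p

alternating-tail : ∀ {a s} → Alternating (a ∷ s) → Alternating s
alternating-tail {s = []}    _       = tt
alternating-tail {s = _ ∷ _} (_ , a) = a

alternating-after-N̄ : ∀ {s} → KnightFrom 0 s → Alternating s → Alternating (N̄ ∷ s)
alternating-after-N̄ done      _ = tt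
alternating-after-N̄ (stepN _) a = (λ ()) , a
alternating-after-N̄ (stepE _) a = (λ ()) , a

zigzag⇒tree : ∀ {s} → Zigzag s → Knight.Tree s
zigzag⇒tree (k , a) = Knight.path⇒tree (knight⇒path {d = N̄} refl k (alternating-after-N̄ k a))

tree⇒zigzag : ∀ {s} → Knight.Tree s → Zigzag s
tree⇒zigzag t = path⇒knight p , alternating-tail (path⇒alternating {d = N̄} refl p)
  where p = Knight.tree⇒path t

knightFrom-[] : ∀ {h} → KnightFrom h [] → h ≡ 0
knightFrom-[] done = refl

knightFrom-tails : ∀ {h a x x′} → KnightFrom h (a ∷ x) → KnightFrom h (a ∷ x′) →
                   ∃[ h′ ] KnightFrom h′ x × KnightFrom h′ x′
knightFrom-tails (stepN p) (stepN q) = _ , p , q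
knightFrom-tails (stepE p) (stepE q) = _ , p , q
knightFrom-tails (stepN̄ p) (stepN̄ q) = _ , p , q
knightFrom-tails (stepĒ p) (stepĒ q) = _ , p , q

knightFrom0-¬EN̄ : ∀ {a z w y} → KnightFrom 0 (a ∷ z) → (a ∷ z) ++ w ≢ E ∷ N̄ ∷ y
knightFrom0-¬EN̄ (stepN _)         ()
knightFrom0-¬EN̄ (stepE (stepN _)) ()
knightFrom0-¬EN̄ (stepE (stepE _)) ()
knightFrom0-¬EN̄ (stepE (stepĒ _)) ()

module KnightSplit =
  FirstSeparator KnightFrom (E ∷ N̄ ∷ []) knightFrom-[] knightFrom-tails knightFrom0-¬EN̄

phi-total : ∀ {s} → Knight.Tree s → ∃[ d ] Phi s d
phi-total leaf         = _ , φε
phi-total (level NN̄ t) = _ , φNN̄ (tree⇒zigzag t) (proj₂ (phi-total t))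
phi-total (level EĒ t) = _ , φEĒ (tree⇒zigzag t) (proj₂ (phi-total t))
phi-total (node t t′)  =
  _ , φNĒ (tree⇒zigzag t) (tree⇒zigzag t′) (proj₂ (phi-total t)) (proj₂ (phi-total t′))

phi⇒tree : ∀ {s d} → Phi s d → Dyck.Tree d
phi⇒tree φε              = Dyck.node Dyck.leaf Dyck.leaf
phi⇒tree (φEĒ _ p)       = Dyck.node (phi⇒tree p) Dyck.leaf
phi⇒tree (φNN̄ _ p)       = Dyck.node Dyck.leaf (phi⇒tree p)
phi⇒tree (φNĒ _ _ p q)   = Dyck.node (phi⇒tree p) (phi⇒tree q)

phi-dyck : ∀ {s d} → Phi s d → DyckPath d
phi-dyck p = path⇒dyckFrom (Dyck.tree⇒path (phi⇒tree p))

length-∷-++-∷ : ∀ {A : Set} (a b : A) x y → length (a ∷ x ++ b ∷ y) ≡ 2 + (length x + length y)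
length-∷-++-∷ _ b x y = cong suc (trans (length-++-sucʳ x b y) (cong suc (length-++ x)))

phi-length : ∀ {s d} → Phi s d → length d ≡ 2 + length s
phi-length φε = refl
phi-length (φEĒ {d = d} _ p) = begin
  length (U ∷ d ++ D ∷ [])  ≡⟨ length-∷-++-∷ U D d [] ⟩
  2 + (length d + 0)        ≡⟨ cong (2 +_) (+-identityʳ (length d)) ⟩
  2 + length d              ≡⟨ cong (2 +_) (phi-length p) ⟩
  4 + _                     ∎
  where open ≡-Reasoning
phi-length (φNN̄ _ p) = cong (2 +_) (phi-length p)
phi-length (φNĒ {β} {γ} {d} {e} _ _ p q) = begin
  length (U ∷ d ++ D ∷ e)                ≡⟨ length-∷-++-∷ U D d e ⟩
  2 + (length d + length e)              ≡⟨ cong (2 +_) (cong₂ _+_ (phi-length p) (phi-length q)) ⟩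
  4 + (length β + length (E ∷ N̄ ∷ γ))    ≡⟨ cong (4 +_) (length-++ β) ⟨
  4 + length (β ++ E ∷ N̄ ∷ γ)            ∎
  where open ≡-Reasoning

phi-functional : ∀ {s s′ d d′} → Phi s d → Phi s′ d′ → s ≡ s′ → d ≡ d′
phi-functional φε φε _ = refl
phi-functional (φEĒ _ p) (φEĒ _ q) eq =
  cong (λ x → U ∷ x ++ D ∷ []) (phi-functional p q (∷-injectiveʳ (∷-injectiveʳ eq)))
phi-functional (φNN̄ _ p) (φNN̄ _ q) eq =
  cong (λ x → U ∷ D ∷ x) (phi-functional p q (∷-injectiveʳ (∷-injectiveʳ eq)))
phi-functional (φNĒ zβ _ p p′) (φNĒ zβ′ _ q q′) eq
  with KnightSplit.split (proj₁ zβ) (proj₁ zβ′) (∷-injectiveʳ (∷-injectiveʳ eq))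
... | β≡β′ , γ≡γ′ =
  cong₂ (λ x y → U ∷ x ++ D ∷ y) (phi-functional p q β≡β′) (phi-functional p′ q′ γ≡γ′)
phi-functional φε (φEĒ _ _) ()
phi-functional φε (φNN̄ _ _) ()
phi-functional φε (φNĒ _ _ _ _) ()
phi-functional (φEĒ _ _) φε ()
phi-functional (φEĒ _ _) (φNN̄ _ _) ()
phi-functional (φEĒ _ _) (φNĒ _ _ _ _) ()
phi-functional (φNN̄ _ _) φε ()
phi-functional (φNN̄ _ _) (φEĒ _ _) ()
phi-functional (φNN̄ _ _) (φNĒ _ _ _ _) ()
phi-functional (φNĒ _ _ _ _) φε ()
phi-functional (φNĒ _ _ _ _) (φEĒ _ _) ()
phi-functional (φNĒ _ _ _ _) (φNN̄ _ _) ()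

phi-nonempty : ∀ {s d} → Phi s d → d ≢ []
phi-nonempty φε            ()
phi-nonempty (φEĒ _ _)     ()
phi-nonempty (φNN̄ _ _)     ()
phi-nonempty (φNĒ _ _ _ _) ()

-- Every value of φ has the form U x D y, with (x, y) empty or not according
-- to the clause; both parts are recovered by splitting at the first return.
phi-injective : ∀ {s s′ d d′} → Phi s d → Phi s′ d′ → d ≡ d′ → s ≡ s′
phi-injective φε φε _ = refl
phi-injective (φEĒ _ p) (φEĒ _ q) eq =
  cong (λ β → E ∷ Ē ∷ β) (phi-injective p q (proj₁ (first-return (phi-dyck p) (phi-dyck q) eq)))
phi-injective (φNN̄ _ p) (φNN̄ _ q) eq =
  cong (λ β → N ∷ N̄ ∷ β) (phi-injective p q (∷-injectiveʳ (∷-injectiveʳ eq)))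
phi-injective (φNĒ _ _ p p′) (φNĒ _ _ q q′) eq with first-return (phi-dyck p) (phi-dyck q) eq
... | d≡d′ , e≡e′ =
  cong₂ (λ β γ → N ∷ Ē ∷ β ++ E ∷ N̄ ∷ γ) (phi-injective p q d≡d′) (phi-injective p′ q′ e≡e′)
phi-injective φε (φEĒ _ q) eq =
  ⊥-elim (phi-nonempty q (sym (proj₁ (first-return done (phi-dyck q) eq))))
phi-injective φε (φNN̄ _ q) eq =
  ⊥-elim (phi-nonempty q (sym (proj₂ (first-return done done eq))))
phi-injective φε (φNĒ _ _ q _) eq =
  ⊥-elim (phi-nonempty q (sym (proj₁ (first-return done (phi-dyck q) eq))))
phi-injective (φEĒ _ p) φε eq =
  ⊥-elim (phi-nonempty p (proj₁ (first-return (phi-dyck p) done eq)))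
phi-injective (φEĒ _ p) (φNN̄ _ _) eq =
  ⊥-elim (phi-nonempty p (proj₁ (first-return (phi-dyck p) done eq)))
phi-injective (φEĒ _ p) (φNĒ _ _ q r) eq =
  ⊥-elim (phi-nonempty r (sym (proj₂ (first-return (phi-dyck p) (phi-dyck q) eq))))
phi-injective (φNN̄ _ p) φε eq =
  ⊥-elim (phi-nonempty p (proj₂ (first-return done done eq)))
phi-injective (φNN̄ _ _) (φEĒ _ q) eq =
  ⊥-elim (phi-nonempty q (sym (proj₁ (first-return done (phi-dyck q) eq))))
phi-injective (φNN̄ _ _) (φNĒ _ _ q _) eq =
  ⊥-elim (phi-nonempty q (sym (proj₁ (first-return done (phi-dyck q) eq))))
phi-injective (φNĒ _ _ p _) φε eq =
  ⊥-elim (phi-nonempty p (proj₁ (first-return (phi-dyck p) done eq)))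
phi-injective (φNĒ _ _ p r) (φEĒ _ q) eq =
  ⊥-elim (phi-nonempty r (proj₂ (first-return (phi-dyck p) (phi-dyck q) eq)))
phi-injective (φNĒ _ _ p _) (φNN̄ _ _) eq =
  ⊥-elim (phi-nonempty p (proj₁ (first-return (phi-dyck p) done eq)))

phi-preimage : ∀ {x y} → Dyck.Tree x → Dyck.Tree y →
               ∃[ s ] Knight.Tree s × Phi s (U ∷ x ++ D ∷ y)
phi-preimage (Dyck.level () _) _
phi-preimage _ (Dyck.level () _)
phi-preimage Dyck.leaf Dyck.leaf = [] , leaf , φε
phi-preimage Dyck.leaf (Dyck.node a b) =
  let s , t , p = phi-preimage a b in N ∷ N̄ ∷ s , level NN̄ t , φNN̄ (tree⇒zigzag t) p
phi-preimage (Dyck.node a b) Dyck.leaf =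
  let s , t , p = phi-preimage a b in E ∷ Ē ∷ s , level EĒ t , φEĒ (tree⇒zigzag t) p
phi-preimage (Dyck.node a b) (Dyck.node c e) =
  let s , t , p = phi-preimage a b
      s′ , t′ , p′ = phi-preimage c e
  in _ , node t t′ , φNĒ (tree⇒zigzag t) (tree⇒zigzag t′) p p′

phi-surjective : ∀ {d} → DyckPath d → d ≢ [] → ∃[ s ] Zigzag s × Phi s d
phi-surjective dyck d≢[] with Dyck.path⇒tree (dyckFrom⇒path dyck)
... | Dyck.leaf = ⊥-elim (d≢[] refl)
... | Dyck.level () _
... | Dyck.node x y = let s , t , p = phi-preimage x y in s , tree⇒zigzag t , p

theorem5 : (n : ℕ) →
    ((s : List KStep) → InS n s →
       Σ (List DStep) (λ d → Phi s d × InD (suc n) d × ((d′ : List DStep) → Phi s d′ → d′ ≡ d)))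
    × ((s s′ : List KStep) (d : List DStep) → InS n s → InS n s′ → Phi s d → Phi s′ d → s ≡ s′)
    × ((d : List DStep) → InD (suc n) d → Σ (List KStep) (λ s → InS n s × Phi s d))
theorem5 n = image , (λ _ _ _ _ _ p p′ → phi-injective p p′ refl) , preimage
  where
  image : (s : List KStep) → InS n s →
          Σ (List DStep) (λ d → Phi s d × InD (suc n) d × ((d′ : List DStep) → Phi s d′ → d′ ≡ d))
  image s (zigzag , len) =
    let d , p = phi-total (zigzag⇒tree zigzag)
    in d , p , (phi-dyck p , trans (phi-length p) (trans (cong (2 +_) len) (sym (*-suc 2 n))))
       , λ _ p′ → phi-functional p′ p refl

  preimage : (d : List DStep) → InD (suc n) d → Σ (List KStep) (λ s → InS n s × Phi s d)
  preimage []      (_ , ())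
  preimage (_ ∷ _) (dyck , len) =
    let s , zigzag , p = phi-surjective dyck (λ ())
    in s , (zigzag , +-cancelˡ-≡ 2 _ _ (trans (sym (phi-length p)) (trans len (*-suc 2 n)))) , p
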